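{- For all integers $m,n\ge3$ and every integer $k\ge1$, \[\gamma_{[k]R}(C_m\square C_n)\ge\frac{(k+1)mn}{5}.\]
   Context: $C_m$ is the cycle on $m$ vertices and $\square$ the Cartesian product. For an integer $k\ge1$ and a labeling $f:V(G)\to\{0,1,\dots,k+1\}$, let $AN(v)=\{u\in N(v): f(u)>0\}$. The labeling $f$ is a $[k]$-Roman dominating function if every vertex $v$ with $f(v)<k$ satisfies $f(N[v])\ge k+|AN(v)|$, where $N[v]=N(v)\cup\{v\}$ and $f(X)=\sum_{x\in X}f(x)$. $\gamma_{[k]R}(G)$ is the minimum of $\sum_v f(v)$ over all $[k]$-Roman dominating functions $f$ on $G$. -}

module Defs where

open import Data.Nat using (ℕ; zero; suc; _+_; _*_; _≤_; _<_; _∸_)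
open import Data.Nat.Properties using (_≤?_) renaming (_≟_ to _≟ℕ_)
open import Data.Fin using (Fin; toℕ)
open import Data.Product using (_×_; _,_)
open import Data.Sum using (_⊎_)
open import Data.Nat.ListAction using (sum)
open import Data.List using (List; map; filter; length; allFin; cartesianProduct)
open import Relation.Binary.PropositionalEquality using (_≡_)
open import Relation.Nullary using (Dec; ¬_)
open import Relation.Nullary.Decidable using (_⊎-dec_; _×-dec_)

Succ : (m : ℕ) → Fin m → Fin m → Set
Succ m i j = (toℕ i + 1 ≡ toℕ j) ⊎ ((toℕ i ≡ m ∸ 1) × (toℕ j ≡ 0))

succ? : (m : ℕ) → (i j : Fin m) → Dec (Succ m i j)
succ? m i j = (toℕ i + 1 ≟ℕ toℕ j) ⊎-dec ((toℕ i ≟ℕ m ∸ 1) ×-dec (toℕ j ≟ℕ 0))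

CycAdj : (m : ℕ) → Fin m → Fin m → Set
CycAdj m i j = Succ m i j ⊎ Succ m j i

cycAdj? : (m : ℕ) → (i j : Fin m) → Dec (CycAdj m i j)
cycAdj? m i j = succ? m i j ⊎-dec succ? m j i

V : ℕ → ℕ → Set
V m n = Fin m × Fin n

Adj : (m n : ℕ) → V m n → V m n → Set
Adj m n (a , b) (c , d) = ((a ≡ c) × CycAdj n b d) ⊎ ((b ≡ d) × CycAdj m a c)

adj? : (m n : ℕ) → (u v : V m n) → Dec (Adj m n u v)
adj? m n (a , b) (c , d) =
  ((a Data.Fin.≟ c) ×-dec cycAdj? n b d) ⊎-dec ((b Data.Fin.≟ d) ×-dec cycAdj? m a c)
  where import Data.Fin

vertices : (m n : ℕ) → List (V m n)
vertices m n = cartesianProduct (allFin m) (allFin n)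

nbrs : (m n : ℕ) → V m n → List (V m n)
nbrs m n v = filter (adj? m n v) (vertices m n)

wt : ∀ {m n} → (V m n → ℕ) → List (V m n) → ℕ
wt f xs = sum (map f xs)

activeCount : (m n : ℕ) → (V m n → ℕ) → V m n → ℕ
activeCount m n f v = length (filter (λ u → 1 ≤? f u) (nbrs m n v))

IsKRDF : (k m n : ℕ) → (V m n → ℕ) → Set
IsKRDF k m n f =
  (∀ v → f v ≤ k + 1) ×
  (∀ v → f v < k → k + activeCount m n f v ≤ f v + wt f (nbrs m n v))

weight : (m n : ℕ) → (V m n → ℕ) → ℕ
weight m n f = wt f (vertices m n)

module Submission where

-- Discharging on an r-regular graph, r ≥ 2. Call v lonely if f(v) = k and f(N(v)) = 0.
-- Give v the charge r·f(N[v]) + r·[v lonely] − #(lonely neighbours of v); as every lonely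
-- vertex has exactly r neighbours, the total charge is r(r+1)·w(f). Each vertex has charge
-- at least r(k+1): a lonely vertex has exactly that; a non-lonely vertex with no lonely
-- neighbour has f(N[v]) ≥ k+1 by the Roman condition; and a neighbour v of a lonely vertex
-- has f(v) = 0 and at least two active neighbours, so f(N(v)) ≥ k + |AN(v)| pays for its at
-- most |AN(v)| lonely neighbours. Hence (k+1)|V| ≤ (r+1)·w(f), and C_m □ C_n is 4-regular.

open import Defs
open import Data.Bool using (if_then_else_)
open import Data.Fin as Fin using (Fin; toℕ)
open import Data.Fin.Properties using (toℕ-injective; toℕ<n; toℕ-fromℕ; toℕ-fromℕ<; toℕ-inject₁)
open import Data.List using (List; []; _∷_; [_]; map; filter; length; allFin; cartesianProduct; _++_)
open import Data.List.Membership.Propositional using (_∈_)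
open import Data.List.Membership.Propositional.Properties using (∈-allFin; ∈-cartesianProduct⁺; ∈-filter⁺; ∈-filter⁻)
open import Data.List.Properties using (map-∘; map-++; map-tabulate; length-++; length-map; length-tabulate)
open import Data.List.Relation.Unary.Any using (here; there)
open import Data.Nat using (ℕ; zero; suc; _+_; _*_; _≤_; _<_; _∸_; z≤n; s≤s; s≤s⁻¹; >-nonZero)
open import Data.Nat.ListAction using (sum)
open import Data.Nat.ListAction.Properties using (sum-++)
open import Data.Nat.Properties
open import Data.Nat.Tactic.RingSolver using (solve-∀)
open import Data.Product using (∃; _×_; _,_; proj₁; proj₂)
open import Data.Sum using (inj₁; inj₂; swap)
open import Function using (_∘_; id)
open import Relation.Binary using (Symmetric; tri<; tri≈; tri>)
open import Relation.Binary.PropositionalEquality using (_≡_; _≢_; refl; sym; trans; cong; cong₂; subst; module ≡-Reasoning)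
open import Relation.Nullary using (Dec; does; yes; no; ¬_; contradiction)
open import Relation.Nullary.Decidable using (_⊎-dec_; _×-dec_)

private variable
  A B : Set

-- Defined through `does` so that 𝟙 (suc i ≟ suc j) reduces to 𝟙 (i ≟ j).
𝟙 : ∀ {p} {P : Set p} → Dec P → ℕ
𝟙 P? = if does P? then 1 else 0

module _ {p} {P : Set p} where

  𝟙-yes : (P? : Dec P) → P → 𝟙 P? ≡ 1
  𝟙-yes (yes _) _ = refl
  𝟙-yes (no ¬p) p = contradiction p ¬p

  𝟙-no : (P? : Dec P) → ¬ P → 𝟙 P? ≡ 0
  𝟙-no (yes p) ¬p = contradiction p ¬p
  𝟙-no (no _)  _  = refl

  𝟙≢0⇒ : (P? : Dec P) → 𝟙 P? ≢ 0 → P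
  𝟙≢0⇒ (yes p) _   = p
  𝟙≢0⇒ (no _)  1≢0 = contradiction refl 1≢0

  𝟙≤1 : (P? : Dec P) → 𝟙 P? ≤ 1
  𝟙≤1 (yes _) = s≤s z≤n
  𝟙≤1 (no _)  = z≤n

module _ {p q} {P : Set p} {Q : Set q} where

  𝟙-cong : (P? : Dec P) (Q? : Dec Q) → (P → Q) → (Q → P) → 𝟙 P? ≡ 𝟙 Q?
  𝟙-cong (yes p) Q? P→Q _   = sym (𝟙-yes Q? (P→Q p))
  𝟙-cong (no ¬p) Q? _   Q→P = sym (𝟙-no Q? (¬p ∘ Q→P))

  𝟙-⊎ : (P? : Dec P) (Q? : Dec Q) → ¬ (P × Q) → 𝟙 (P? ⊎-dec Q?) ≡ 𝟙 P? + 𝟙 Q?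
  𝟙-⊎ (yes p) (yes q) disjoint = contradiction (p , q) disjoint
  𝟙-⊎ (yes _) (no _)  _        = refl
  𝟙-⊎ (no _)  (yes _) _        = refl
  𝟙-⊎ (no _)  (no _)  _        = refl

  𝟙-× : (P? : Dec P) (Q? : Dec Q) → 𝟙 (P? ×-dec Q?) ≡ 𝟙 P? * 𝟙 Q?
  𝟙-× (yes _) (yes _) = refl
  𝟙-× (yes _) (no _)  = refl
  𝟙-× (no _)  (yes _) = refl
  𝟙-× (no _)  (no _)  = refl

∑ : {A : Set} → List A → (A → ℕ) → ℕ
∑ xs g = sum (map g xs)

∑-cong : ∀ xs {g h : A → ℕ} → (∀ x → g x ≡ h x) → ∑ xs g ≡ ∑ xs h
∑-cong []       _   = refl
∑-cong (x ∷ xs) g≗h = cong₂ _+_ (g≗h x) (∑-cong xs g≗h)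

∑-+ : ∀ xs (g h : A → ℕ) → ∑ xs (λ x → g x + h x) ≡ ∑ xs g + ∑ xs h
∑-+ []       g h = refl
∑-+ (x ∷ xs) g h rewrite ∑-+ xs g h = +-assoc-swap (g x) (h x) (∑ xs g) (∑ xs h)
  where
  +-assoc-swap : ∀ a b c d → a + b + (c + d) ≡ a + c + (b + d)
  +-assoc-swap = solve-∀

∑-*ˡ : ∀ xs c (g : A → ℕ) → ∑ xs (λ x → c * g x) ≡ c * ∑ xs g
∑-*ˡ []       c g = sym (*-zeroʳ c)
∑-*ˡ (x ∷ xs) c g = trans (cong (c * g x +_) (∑-*ˡ xs c g)) (sym (*-distribˡ-+ c (g x) (∑ xs g)))

∑-*ʳ : ∀ xs c (g : A → ℕ) → ∑ xs (λ x → g x * c) ≡ ∑ xs g * c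
∑-*ʳ xs c g = trans (∑-cong xs (λ x → *-comm (g x) c)) (trans (∑-*ˡ xs c g) (*-comm c (∑ xs g)))

∑-const : ∀ xs c → ∑ xs (λ (_ : A) → c) ≡ c * length xs
∑-const []       c = sym (*-zeroʳ c)
∑-const (x ∷ xs) c = trans (cong (c +_) (∑-const xs c)) (sym (*-suc c (length xs)))

∑-mono : ∀ xs {g h : A → ℕ} → (∀ x → g x ≤ h x) → ∑ xs g ≤ ∑ xs h
∑-mono []       _   = z≤n
∑-mono (x ∷ xs) g≤h = +-mono-≤ (g≤h x) (∑-mono xs g≤h)

∑≤length : ∀ xs {g : A → ℕ} → (∀ x → g x ≤ 1) → ∑ xs g ≤ length xs
∑≤length xs g≤1 = ≤-trans (∑-mono xs g≤1) (≤-reflexive (trans (∑-const xs 1) (*-identityˡ (length xs))))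

∈⇒≤∑ : ∀ {xs : List A} {x} (g : A → ℕ) → x ∈ xs → g x ≤ ∑ xs g
∈⇒≤∑ {xs = y ∷ xs} g (here refl) = m≤m+n (g y) (∑ xs g)
∈⇒≤∑ {xs = y ∷ xs} g (there x∈) = ≤-trans (∈⇒≤∑ g x∈) (m≤n+m (∑ xs g) (g y))

∑≡0⇒ : ∀ {xs : List A} {x} (g : A → ℕ) → ∑ xs g ≡ 0 → x ∈ xs → g x ≡ 0
∑≡0⇒ g ∑≡0 x∈ = n≤0⇒n≡0 (subst (_ ≤_) ∑≡0 (∈⇒≤∑ g x∈))

∑≢0⇒ : ∀ xs (g : A → ℕ) → ∑ xs g ≢ 0 → ∃ λ x → x ∈ xs × g x ≢ 0
∑≢0⇒ []       g ∑≢0 = contradiction refl ∑≢0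
∑≢0⇒ (x ∷ xs) g ∑≢0 with g x ≟ 0
... | no  gx≢0 = x , here refl , gx≢0
... | yes gx≡0 with ∑≢0⇒ xs g (∑≢0 ∘ trans (cong (_+ ∑ xs g) gx≡0))
...   | y , y∈ , gy≢0 = y , there y∈ , gy≢0

∑-zero : ∀ xs {g : A → ℕ} → (∀ x → x ∈ xs → g x ≡ 0) → ∑ xs g ≡ 0
∑-zero []       _    = refl
∑-zero (x ∷ xs) g≡0 = cong₂ _+_ (g≡0 x (here refl)) (∑-zero xs (λ y → g≡0 y ∘ there))

length≡0⇒∑≡0 : ∀ xs {g : A → ℕ} → length xs ≡ 0 → ∑ xs g ≡ 0
length≡0⇒∑≡0 [] _ = refl

∑-filter : ∀ {p} {P : A → Set p} (P? : ∀ x → Dec (P x)) xs (g : A → ℕ) →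
           ∑ (filter P? xs) g ≡ ∑ xs (λ x → 𝟙 (P? x) * g x)
∑-filter P? []       g = refl
∑-filter P? (x ∷ xs) g with P? x
... | yes _ = cong₂ _+_ (sym (+-identityʳ (g x))) (∑-filter P? xs g)
... | no  _ = ∑-filter P? xs g

∑-filter-support : ∀ {p} {P : A → Set p} (P? : ∀ x → Dec (P x)) xs (g : A → ℕ) →
                   (∀ x → ¬ P x → g x ≡ 0) → ∑ (filter P? xs) g ≡ ∑ xs g
∑-filter-support P? xs g supp = trans (∑-filter P? xs g) (∑-cong xs outside)
  where
  outside : ∀ x → 𝟙 (P? x) * g x ≡ g x
  outside x with P? x
  ... | yes _  = +-identityʳ (g x)
  ... | no ¬px = sym (supp x ¬px)

∈-length<2 : ∀ {xs : List A} {x} → x ∈ xs → length xs < 2 → xs ≡ [ x ]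
∈-length<2 {xs = _ ∷ []}    (here refl) _ = refl
∈-length<2 {xs = _ ∷ _ ∷ _} _ (s≤s (s≤s ()))

∑-swap : ∀ xs (ys : List B) (G : A → B → ℕ) →
         ∑ xs (λ x → ∑ ys (G x)) ≡ ∑ ys (λ y → ∑ xs (λ x → G x y))
∑-swap []       ys G = sym (∑-const ys 0)
∑-swap (x ∷ xs) ys G =
  trans (cong (∑ ys (G x) +_) (∑-swap xs ys G)) (sym (∑-+ ys (G x) (λ y → ∑ xs (λ x → G x y))))

∑-cartesianProduct : ∀ xs (ys : List B) (g : A × B → ℕ) →
                     ∑ (cartesianProduct xs ys) g ≡ ∑ xs (λ x → ∑ ys (λ y → g (x , y)))
∑-cartesianProduct []       ys g = refl
∑-cartesianProduct (x ∷ xs) ys g = begin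
  sum (map g (map (x ,_) ys ++ cartesianProduct xs ys))
    ≡⟨ cong sum (map-++ g (map (x ,_) ys) (cartesianProduct xs ys)) ⟩
  sum (map g (map (x ,_) ys) ++ map g (cartesianProduct xs ys))
    ≡⟨ sum-++ (map g (map (x ,_) ys)) _ ⟩
  sum (map g (map (x ,_) ys)) + ∑ (cartesianProduct xs ys) g
    ≡⟨ cong₂ _+_ (cong sum (sym (map-∘ ys))) (∑-cartesianProduct xs ys g) ⟩
  ∑ ys (λ y → g (x , y)) + ∑ xs (λ x → ∑ ys (λ y → g (x , y)))
    ∎
  where open ≡-Reasoning

∑-cartesianProduct-* : ∀ xs (ys : List B) (g : A → ℕ) (h : B → ℕ) →
                       ∑ (cartesianProduct xs ys) (λ p → g (proj₁ p) * h (proj₂ p)) ≡ ∑ xs g * ∑ ys h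
∑-cartesianProduct-* xs ys g h =
  trans (∑-cartesianProduct xs ys _)
        (trans (∑-cong xs (λ x → ∑-*ˡ ys (g x) h)) (∑-*ʳ xs (∑ ys h) g))

length-cartesianProduct : ∀ (xs : List A) (ys : List B) →
                          length (cartesianProduct xs ys) ≡ length xs * length ys
length-cartesianProduct []       ys = refl
length-cartesianProduct (x ∷ xs) ys =
  trans (length-++ (map (x ,_) ys))
        (cong₂ _+_ (length-map (x ,_) ys) (length-cartesianProduct xs ys))

∑-allFin-suc : ∀ n (g : Fin (suc n) → ℕ) → ∑ (allFin (suc n)) g ≡ g Fin.zero + ∑ (allFin n) (g ∘ Fin.suc)
∑-allFin-suc n g =
  cong (g Fin.zero +_) (trans (cong sum (map-tabulate Fin.suc g)) (sym (cong sum (map-tabulate id (g ∘ Fin.suc)))))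

count-≟ : ∀ {n} (s : Fin n) → ∑ (allFin n) (λ c → 𝟙 (s Fin.≟ c)) ≡ 1
count-≟ {suc n} Fin.zero    = trans (∑-allFin-suc n (λ c → 𝟙 (Fin.zero Fin.≟ c))) (cong suc (∑-const (allFin n) 0))
count-≟ {suc n} (Fin.suc s) = trans (∑-allFin-suc n (λ c → 𝟙 (Fin.suc s Fin.≟ c))) (count-≟ s)

count-unique : ∀ {n p} {P : Fin n → Set p} (P? : ∀ c → Dec (P c)) {s} →
               P s → (∀ c → P c → c ≡ s) → ∑ (allFin n) (λ c → 𝟙 (P? c)) ≡ 1
count-unique {P = P} P? {s} Ps unique =
  trans (∑-cong (allFin _) (λ c → 𝟙-cong (P? c) (s Fin.≟ c) (sym ∘ unique c) (λ s≡c → subst P s≡c Ps)))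
        (count-≟ s)

succ-exists : ∀ {m} (i : Fin m) → ∃ (Succ m i)
succ-exists {suc m} i with suc (toℕ i) <? suc m
... | yes i+1<m = Fin.fromℕ< i+1<m , inj₁ (trans (+-comm (toℕ i) 1) (sym (toℕ-fromℕ< i+1<m)))
... | no  i+1≮m = Fin.zero , inj₂ (≤-antisym (s≤s⁻¹ (toℕ<n i)) (s≤s⁻¹ (≮⇒≥ i+1≮m)) , refl)

pred-exists : ∀ {m} (j : Fin m) → ∃ λ i → Succ m i j
pred-exists {suc m} Fin.zero    = Fin.fromℕ m , inj₂ (toℕ-fromℕ m , refl)
pred-exists {suc m} (Fin.suc j) =
  Fin.inject₁ j , inj₁ (trans (cong (_+ 1) (toℕ-inject₁ j)) (+-comm (toℕ j) 1))

last+1≢ : ∀ {m} (i j : Fin m) → toℕ i ≡ m ∸ 1 → toℕ i + 1 ≢ toℕ j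
last+1≢ {suc m} i j i≡m i+1≡j =
  <-irrefl (trans (sym i+1≡j) (trans (cong (_+ 1) i≡m) (+-comm m 1))) (toℕ<n j)

1≢2+ : ∀ {r} → 1 ≢ suc (suc r)
1≢2+ ()

+1≢0 : ∀ x → x + 1 ≢ 0
+1≢0 x = 1+n≢0 ∘ trans (+-comm 1 x)

succ-functional : ∀ {m} {i j j′ : Fin m} → Succ m i j → Succ m i j′ → j ≡ j′
succ-functional (inj₁ i+1≡j)        (inj₁ i+1≡j′)        = toℕ-injective (trans (sym i+1≡j) i+1≡j′)
succ-functional (inj₂ (_ , j≡0))    (inj₂ (_ , j′≡0))    = toℕ-injective (trans j≡0 (sym j′≡0))
succ-functional (inj₁ i+1≡j)        (inj₂ (i≡last , _)) = contradiction i+1≡j (last+1≢ _ _ i≡last)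
succ-functional (inj₂ (i≡last , _)) (inj₁ i+1≡j′)        = contradiction i+1≡j′ (last+1≢ _ _ i≡last)

succ-injective : ∀ {m} {i i′ j : Fin m} → Succ m i j → Succ m i′ j → i ≡ i′
succ-injective (inj₁ i+1≡j)        (inj₁ i′+1≡j)        = toℕ-injective (+-cancelʳ-≡ 1 _ _ (trans i+1≡j (sym i′+1≡j)))
succ-injective (inj₂ (i≡last , _)) (inj₂ (i′≡last , _)) = toℕ-injective (trans i≡last (sym i′≡last))
succ-injective (inj₁ i+1≡j)        (inj₂ (_ , j≡0))     = contradiction (trans i+1≡j j≡0) (+1≢0 _)
succ-injective (inj₂ (_ , j≡0))    (inj₁ i′+1≡j)        = contradiction (trans i′+1≡j j≡0) (+1≢0 _)

succ-asym : ∀ {m} → 3 ≤ m → {i j : Fin m} → Succ m i j → ¬ Succ m j i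
succ-asym (s≤s (s≤s (s≤s _))) {i} (inj₁ i+1≡j) (inj₁ j+1≡i) =
  m≢1+m+n (toℕ i) (sym (trans (sym (+-comm (toℕ i + 1) 1)) (trans (cong (_+ 1) i+1≡j) j+1≡i)))
succ-asym (s≤s (s≤s (s≤s _))) (inj₁ i+1≡j) (inj₂ (j≡last , i≡0)) =
  1≢2+ (trans (sym (cong (_+ 1) i≡0)) (trans i+1≡j j≡last))
succ-asym (s≤s (s≤s (s≤s _))) (inj₂ (i≡last , j≡0)) (inj₁ j+1≡i) =
  1≢2+ (trans (sym (cong (_+ 1) j≡0)) (trans j+1≡i i≡last))
succ-asym (s≤s (s≤s (s≤s _))) (inj₂ (i≡last , _)) (inj₂ (_ , i≡0)) with () ← trans (sym i≡0) i≡last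

cycAdj-irrefl : ∀ {m} → 3 ≤ m → (i : Fin m) → ¬ CycAdj m i i
cycAdj-irrefl m≥3 i (inj₁ i→i) = succ-asym m≥3 i→i i→i
cycAdj-irrefl m≥3 i (inj₂ i→i) = succ-asym m≥3 i→i i→i

cycAdj-sym : ∀ {m} → Symmetric (CycAdj m)
cycAdj-sym = swap

cycle-degree : ∀ {m} → 3 ≤ m → (i : Fin m) → ∑ (allFin m) (λ j → 𝟙 (cycAdj? m i j)) ≡ 2
cycle-degree {m} m≥3 i = begin
  ∑ (allFin m) (λ j → 𝟙 (cycAdj? m i j))
    ≡⟨ ∑-cong (allFin m) (λ j → 𝟙-⊎ (succ? m i j) (succ? m j i) (λ (i→j , j→i) → succ-asym m≥3 i→j j→i)) ⟩
  ∑ (allFin m) (λ j → 𝟙 (succ? m i j) + 𝟙 (succ? m j i))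
    ≡⟨ ∑-+ (allFin m) _ _ ⟩
  ∑ (allFin m) (λ j → 𝟙 (succ? m i j)) + ∑ (allFin m) (λ j → 𝟙 (succ? m j i))
    ≡⟨ cong₂ _+_ (count-unique (succ? m i) (proj₂ (succ-exists i)) (λ j i→j → succ-functional i→j (proj₂ (succ-exists i))))
                 (count-unique (λ j → succ? m j i) (proj₂ (pred-exists i)) (λ j j→i → succ-injective j→i (proj₂ (pred-exists i)))) ⟩
  2 ∎
  where open ≡-Reasoning

adj-sym : ∀ {m n} → Symmetric (Adj m n)
adj-sym (inj₁ (a≡c , b~d)) = inj₁ (sym a≡c , cycAdj-sym b~d)
adj-sym (inj₂ (b≡d , a~c)) = inj₂ (sym b≡d , cycAdj-sym a~c)

torus-degree : ∀ {m n} → 3 ≤ m → 3 ≤ n → (v : V m n) → ∑ (vertices m n) (λ w → 𝟙 (adj? m n v w)) ≡ 4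
torus-degree {m} {n} m≥3 n≥3 (a , b) = begin
  ∑ (vertices m n) (λ w → 𝟙 (adj? m n (a , b) w))
    ≡⟨ ∑-cong (vertices m n) split ⟩
  ∑ (vertices m n) (λ w → vertical w + horizontal w)
    ≡⟨ ∑-+ (vertices m n) vertical horizontal ⟩
  ∑ (vertices m n) vertical + ∑ (vertices m n) horizontal
    ≡⟨ cong₂ _+_ (∑-cartesianProduct-* (allFin m) (allFin n) (λ c → 𝟙 (a Fin.≟ c)) (λ d → 𝟙 (cycAdj? n b d)))
                 (∑-cartesianProduct-* (allFin m) (allFin n) (λ c → 𝟙 (cycAdj? m a c)) (λ d → 𝟙 (b Fin.≟ d))) ⟩
  ∑ (allFin m) (λ c → 𝟙 (a Fin.≟ c)) * ∑ (allFin n) (λ d → 𝟙 (cycAdj? n b d))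
    + ∑ (allFin m) (λ c → 𝟙 (cycAdj? m a c)) * ∑ (allFin n) (λ d → 𝟙 (b Fin.≟ d))
    ≡⟨ cong₂ _+_ (cong₂ _*_ (count-≟ a) (cycle-degree n≥3 b)) (cong₂ _*_ (cycle-degree m≥3 a) (count-≟ b)) ⟩
  4 ∎
  where
  open ≡-Reasoning
  vertical horizontal : V m n → ℕ
  vertical   w = 𝟙 (a Fin.≟ proj₁ w) * 𝟙 (cycAdj? n b (proj₂ w))
  horizontal w = 𝟙 (cycAdj? m a (proj₁ w)) * 𝟙 (b Fin.≟ proj₂ w)
  split : ∀ w → 𝟙 (adj? m n (a , b) w) ≡ vertical w + horizontal w
  split (c , d) =
    trans (𝟙-⊎ ((a Fin.≟ c) ×-dec cycAdj? n b d) ((b Fin.≟ d) ×-dec cycAdj? m a c)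
               (λ ((a≡c , _) , (_ , a~c)) → cycAdj-irrefl m≥3 a (subst (CycAdj m a) (sym a≡c) a~c)))
          (cong₂ _+_ (𝟙-× (a Fin.≟ c) (cycAdj? n b d))
                     (trans (𝟙-× (b Fin.≟ d) (cycAdj? m a c)) (*-comm (𝟙 (b Fin.≟ d)) (𝟙 (cycAdj? m a c)))))

length-vertices : ∀ m n → length (vertices m n) ≡ m * n
length-vertices m n =
  trans (length-cartesianProduct (allFin m) (allFin n)) (cong₂ _*_ (length-tabulate {n = m} id) (length-tabulate {n = n} id))

∈-vertices : ∀ {m n} (v : V m n) → v ∈ vertices m n
∈-vertices (a , b) = ∈-cartesianProduct⁺ (∈-allFin a) (∈-allFin b)

r*[k+1]+a≤r*[k+a] : ∀ {r a} k → 2 ≤ r → 2 ≤ a → r * (k + 1) + a ≤ r * (k + a)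
r*[k+1]+a≤r*[k+a] {suc (suc r)} {suc (suc a)} k (s≤s (s≤s _)) (s≤s (s≤s _)) =
  subst ((2 + r) * (k + 1) + (2 + a) ≤_) (sym (expand r a k)) (m≤m+n _ (r + a + r * a))
  where
  expand : ∀ r a k → (2 + r) * (k + (2 + a)) ≡ (2 + r) * (k + 1) + (2 + a) + (r + a + r * a)
  expand = solve-∀

module RegularGraph {V : Set} {E : V → V → Set} (E? : ∀ u v → Dec (E u v)) (E-sym : Symmetric E)
                    (vs : List V) (vs-complete : ∀ v → v ∈ vs)
                    {r : ℕ} (regular : ∀ v → ∑ vs (λ w → 𝟙 (E? v w)) ≡ r) where

  N : V → List V
  N v = filter (E? v) vs

  ∈N-sym : ∀ {u v} → u ∈ N v → v ∈ N u
  ∈N-sym {u} {v} u∈Nv = ∈-filter⁺ (E? u) (vs-complete v) (E-sym (proj₂ (∈-filter⁻ (E? v) {xs = vs} u∈Nv)))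

  ∑-∑N : ∀ (g : V → ℕ) → ∑ vs (λ v → ∑ (N v) g) ≡ r * ∑ vs g
  ∑-∑N g = begin
    ∑ vs (λ v → ∑ (N v) g)                      ≡⟨ ∑-cong vs (λ v → ∑-filter (E? v) vs g) ⟩
    ∑ vs (λ v → ∑ vs (λ u → 𝟙 (E? v u) * g u)) ≡⟨ ∑-swap vs vs (λ v u → 𝟙 (E? v u) * g u) ⟩
    ∑ vs (λ u → ∑ vs (λ v → 𝟙 (E? v u) * g u)) ≡⟨ ∑-cong vs (λ u → ∑-*ʳ vs (g u) (λ v → 𝟙 (E? v u))) ⟩
    ∑ vs (λ u → ∑ vs (λ v → 𝟙 (E? v u)) * g u) ≡⟨ ∑-cong vs (λ u → cong (_* g u) (in-degree u)) ⟩
    ∑ vs (λ u → r * g u)                        ≡⟨ ∑-*ˡ vs r g ⟩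
    r * ∑ vs g                                  ∎
    where
    open ≡-Reasoning
    in-degree : ∀ u → ∑ vs (λ v → 𝟙 (E? v u)) ≡ r
    in-degree u = trans (∑-cong vs (λ v → 𝟙-cong (E? v u) (E? u v) E-sym E-sym)) (regular u)

  active : (V → ℕ) → V → List V
  active f v = filter (λ u → 1 ≤? f u) (N v)

  module Discharging (r≥2 : 2 ≤ r) {k : ℕ} (k≥1 : 1 ≤ k) (f : V → ℕ)
                     (roman : ∀ v → f v < k → k + length (active f v) ≤ f v + ∑ (N v) f) where

    Lonely : V → Set
    Lonely v = f v ≡ k × ∑ (N v) f ≡ 0

    lonely? : ∀ v → Dec (Lonely v)
    lonely? v = (f v ≟ k) ×-dec (∑ (N v) f ≟ 0)

    lonely : V → ℕ
    lonely v = 𝟙 (lonely? v)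

    ∑-active : ∀ v → ∑ (active f v) f ≡ ∑ (N v) f
    ∑-active v = ∑-filter-support (λ u → 1 ≤? f u) (N v) f (λ u 1≰fu → n<1⇒n≡0 (≰⇒> 1≰fu))

    lonely⇒active : ∀ {u} → Lonely u → 1 ≤ f u
    lonely⇒active (fu≡k , _) = subst (1 ≤_) (sym fu≡k) k≥1

    neighbour-of-lonely : ∀ {u v} → u ∈ N v → Lonely u → f v ≡ 0
    neighbour-of-lonely u∈Nv (_ , ∑Nu≡0) = ∑≡0⇒ f ∑Nu≡0 (∈N-sym u∈Nv)

    not-lonely-bound : ∀ v → ¬ Lonely v → k + 1 ≤ f v + ∑ (N v) f
    not-lonely-bound v ¬lonely with <-cmp (f v) k
    ... | tri< fv<k _ _ with length (active f v) ≟ 0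
    ...   | no  A≢0 = ≤-trans (+-monoʳ-≤ k (n≢0⇒n>0 A≢0)) (roman v fv<k)
    ...   | yes A≡0 = contradiction k≤fv (<⇒≱ fv<k)
      where
      open ≤-Reasoning
      k≤fv : k ≤ f v
      k≤fv = begin
        k                              ≡⟨ sym (+-identityʳ k) ⟩
        k + 0                          ≡⟨ cong (k +_) (sym A≡0) ⟩
        k + length (active f v)        ≤⟨ roman v fv<k ⟩
        f v + ∑ (N v) f                ≡⟨ cong (f v +_) (sym (∑-active v)) ⟩
        f v + ∑ (active f v) f         ≡⟨ cong (f v +_) (length≡0⇒∑≡0 (active f v) A≡0) ⟩
        f v + 0                        ≡⟨ +-identityʳ (f v) ⟩
        f v                            ∎
    not-lonely-bound v ¬lonely | tri≈ _ fv≡k _ with ∑ (N v) f ≟ 0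
    ...   | yes ∑N≡0 = contradiction (fv≡k , ∑N≡0) ¬lonely
    ...   | no  ∑N≢0 = +-mono-≤ (≤-reflexive (sym fv≡k)) (n≢0⇒n>0 ∑N≢0)
    not-lonely-bound v ¬lonely | tri> _ _ k<fv =
      ≤-trans (subst (_≤ f v) (+-comm 1 k) k<fv) (m≤m+n (f v) (∑ (N v) f))

    beside-lonely-bound : ∀ {u v} → u ∈ N v → Lonely u → r * (k + 1) + ∑ (N v) lonely ≤ r * ∑ (N v) f
    beside-lonely-bound {u} {v} u∈Nv lonely-u = begin
      r * (k + 1) + ∑ (N v) lonely                 ≡⟨ cong (r * (k + 1) +_) (sym lonely-only-active) ⟩
      r * (k + 1) + ∑ (active f v) lonely          ≤⟨ +-monoʳ-≤ (r * (k + 1)) (∑≤length (active f v) (𝟙≤1 ∘ lonely?)) ⟩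
      r * (k + 1) + length (active f v)            ≤⟨ r*[k+1]+a≤r*[k+a] k r≥2 two-active ⟩
      r * (k + length (active f v))                ≤⟨ *-monoʳ-≤ r bound ⟩
      r * ∑ (N v) f                                ∎
      where
      open ≤-Reasoning
      fv≡0 : f v ≡ 0
      fv≡0 = neighbour-of-lonely u∈Nv lonely-u
      bound : k + length (active f v) ≤ ∑ (N v) f
      bound = subst (λ x → k + length (active f v) ≤ x + ∑ (N v) f) fv≡0 (roman v (subst (_< k) (sym fv≡0) k≥1))
      lonely-only-active : ∑ (active f v) lonely ≡ ∑ (N v) lonely
      lonely-only-active = ∑-filter-support (λ w → 1 ≤? f w) (N v) lonely
                             (λ w 1≰fw → 𝟙-no (lonely? w) (1≰fw ∘ lonely⇒active))
      u-active : u ∈ active f v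
      u-active = ∈-filter⁺ (λ w → 1 ≤? f w) u∈Nv (lonely⇒active lonely-u)
      -- if u were the only active neighbour, the Roman condition at v would read k + 1 ≤ f u = k
      two-active : 2 ≤ length (active f v)
      two-active with 2 ≤? length (active f v)
      ... | yes 2≤A = 2≤A
      ... | no  2≰A = contradiction k+1≤k (λ k+1≤k → n≮n k (subst (_≤ k) (+-comm k 1) k+1≤k))
        where
        active≡[u] : active f v ≡ [ u ]
        active≡[u] = ∈-length<2 u-active (≰⇒> 2≰A)
        k+1≤k : k + 1 ≤ k
        k+1≤k = begin
          k + 1                          ≡⟨ cong (λ xs → k + length xs) (sym active≡[u]) ⟩
          k + length (active f v)        ≤⟨ bound ⟩
          ∑ (N v) f                      ≡⟨ sym (∑-active v) ⟩
          ∑ (active f v) f               ≡⟨ cong (λ xs → ∑ xs f) active≡[u] ⟩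
          f u + 0                        ≡⟨ +-identityʳ (f u) ⟩
          f u                            ≡⟨ proj₁ lonely-u ⟩
          k                              ∎

    r*lonely≡0 : ∀ {v} → ¬ Lonely v → r * lonely v ≡ 0
    r*lonely≡0 {v} ¬lonely-v = trans (cong (r *_) (𝟙-no (lonely? v) ¬lonely-v)) (*-zeroʳ r)

    discharge : ∀ v → r * (k + 1) + ∑ (N v) lonely ≤ r * (f v + ∑ (N v) f) + r * lonely v
    discharge v with lonely? v
    ... | yes lonely-v@(fv≡k , ∑N≡0) = ≤-reflexive (begin-equality
      r * (k + 1) + ∑ (N v) lonely        ≡⟨ cong (r * (k + 1) +_) (∑-zero (N v) no-lonely-neighbour) ⟩
      r * (k + 1) + 0                     ≡⟨ distrib r k ⟩
      r * (k + 0) + r * 1                 ≡⟨ cong₂ (λ x y → r * (x + y) + r * 1) (sym fv≡k) (sym ∑N≡0) ⟩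
      r * (f v + ∑ (N v) f) + r * 1       ≡⟨ cong (λ d → r * (f v + ∑ (N v) f) + r * d) (sym (𝟙-yes (lonely? v) lonely-v)) ⟩
      r * (f v + ∑ (N v) f) + r * lonely v ∎)
      where
      open ≤-Reasoning
      distrib : ∀ r k → r * (k + 1) + 0 ≡ r * (k + 0) + r * 1
      distrib = solve-∀
      no-lonely-neighbour : ∀ u → u ∈ N v → lonely u ≡ 0
      no-lonely-neighbour u u∈Nv = 𝟙-no (lonely? u) λ lonely-u →
        <⇒≢ k≥1 (sym (trans (sym fv≡k) (neighbour-of-lonely u∈Nv lonely-u)))
    ... | no ¬lonely-v with ∑ (N v) lonely ≟ 0
    ...   | yes ∑≡0 = begin
      r * (k + 1) + ∑ (N v) lonely        ≡⟨ cong (r * (k + 1) +_) ∑≡0 ⟩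
      r * (k + 1) + 0                     ≤⟨ +-monoˡ-≤ 0 (*-monoʳ-≤ r (not-lonely-bound v ¬lonely-v)) ⟩
      r * (f v + ∑ (N v) f) + 0           ≡⟨ cong (r * (f v + ∑ (N v) f) +_) (sym (r*lonely≡0 ¬lonely-v)) ⟩
      r * (f v + ∑ (N v) f) + r * lonely v ∎
      where open ≤-Reasoning
    ...   | no  ∑≢0 with ∑≢0⇒ (N v) lonely ∑≢0
    ...     | u , u∈Nv , lonely-u≢0 = begin
      r * (k + 1) + ∑ (N v) lonely        ≤⟨ beside-lonely-bound u∈Nv lonely-u ⟩
      r * ∑ (N v) f                       ≡⟨ sym (+-identityʳ _) ⟩
      r * (0 + ∑ (N v) f) + 0             ≡⟨ cong₂ (λ x y → r * (x + ∑ (N v) f) + y) (sym fv≡0) (sym (r*lonely≡0 ¬lonely-v)) ⟩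
      r * (f v + ∑ (N v) f) + r * lonely v ∎
      where
      open ≤-Reasoning
      lonely-u : Lonely u
      lonely-u = 𝟙≢0⇒ (lonely? u) lonely-u≢0
      fv≡0 : f v ≡ 0
      fv≡0 = neighbour-of-lonely u∈Nv lonely-u

    lower-bound : (k + 1) * length vs ≤ (r + 1) * ∑ vs f
    lower-bound = *-cancelˡ-≤ r {{>-nonZero (≤-trans (s≤s z≤n) r≥2)}}
                    (+-cancelʳ-≤ (r * ∑ vs lonely) _ _ summed)
      where
      open ≤-Reasoning
      summed : r * ((k + 1) * length vs) + r * ∑ vs lonely ≤ r * ((r + 1) * ∑ vs f) + r * ∑ vs lonely
      summed = begin
        r * ((k + 1) * length vs) + r * ∑ vs lonely
          ≡⟨ cong₂ _+_ (trans (sym (*-assoc r (k + 1) (length vs))) (sym (∑-const vs (r * (k + 1))))) (sym (∑-∑N lonely)) ⟩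
        ∑ vs (λ _ → r * (k + 1)) + ∑ vs (λ v → ∑ (N v) lonely)
          ≡⟨ sym (∑-+ vs _ _) ⟩
        ∑ vs (λ v → r * (k + 1) + ∑ (N v) lonely)
          ≤⟨ ∑-mono vs discharge ⟩
        ∑ vs (λ v → r * (f v + ∑ (N v) f) + r * lonely v)
          ≡⟨ ∑-+ vs _ _ ⟩
        ∑ vs (λ v → r * (f v + ∑ (N v) f)) + ∑ vs (λ v → r * lonely v)
          ≡⟨ cong₂ _+_ (∑-*ˡ vs r _) (∑-*ˡ vs r lonely) ⟩
        r * ∑ vs (λ v → f v + ∑ (N v) f) + r * ∑ vs lonely
          ≡⟨ cong (λ x → r * x + r * ∑ vs lonely) (trans (∑-+ vs f _) (cong (∑ vs f +_) (∑-∑N f))) ⟩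
        r * (∑ vs f + r * ∑ vs f) + r * ∑ vs lonely
          ≡⟨ cong (λ x → r * (x * ∑ vs f) + r * ∑ vs lonely) (+-comm 1 r) ⟩
        r * ((r + 1) * ∑ vs f) + r * ∑ vs lonely ∎

mainTheorem6 : (m n k : ℕ) → 3 ≤ m → 3 ≤ n → 1 ≤ k →
    (f : V m n → ℕ) → IsKRDF k m n f →
    (k + 1) * m * n ≤ 5 * weight m n f
mainTheorem6 m n k m≥3 n≥3 k≥1 f (_ , roman) = begin
  (k + 1) * m * n                    ≡⟨ *-assoc (k + 1) m n ⟩
  (k + 1) * (m * n)                  ≡⟨ cong ((k + 1) *_) (sym (length-vertices m n)) ⟩
  (k + 1) * length (vertices m n)    ≤⟨ Torus.Discharging.lower-bound (s≤s (s≤s z≤n)) k≥1 f roman ⟩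
  5 * weight m n f                   ∎
  where
  open ≤-Reasoning
  module Torus = RegularGraph (adj? m n) adj-sym (vertices m n) ∈-vertices (torus-degree m≥3 n≥3)
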